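{- The circuits of the bounded-size partition polytope $PP(\kappa^\pm)$ (with respect to its defining system) are exactly the vectors $g\in\{0,1,-1\}^{kn}$ such that for every $j$ the column $(g_{1j},\dots,g_{kj})$ is either zero or has exactly one entry $1$ and one entry $-1$, and the directed multigraph $D(g)$ on nodes $c_1,\dots,c_k$ with an edge $(c_i,c_\ell)$ labeled $x_j$ whenever $g_{ij}=-1$ and $g_{\ell j}=1$ consists of a single directed cycle (a single cyclical exchange of items among clusters) or a single directed path (a single sequential movement of items among clusters).
   Context: Let $X=\{x_1,\dots,x_n\}$ be items and $k$ clusters, with $\kappa_i^-,\kappa_i^+\in\mathbb Z_+$. $PP(\kappa^\pm)=\{y\in\mathbb R^{kn}: Ay=b,\ By\le d\}$ where $Ay=b$ is the system $\sum_{i=1}^k y_{ij}=1$ ($j=1,\dots,n$) and $By\le d$ consists of $\sum_{j=1}^n y_{ij}\ge\kappa_i^-$, $\sum_{j=1}^n y_{ij}\le\kappa_i^+$ ($i=1,\dots,k$) and $y_{ij}\ge 0$. Its circuits are the $g\in\ker(A)\setminus\{0\}$ with coprime integer components such that the support of $Bg$ is inclusion-minimal among supports of $Bx$, $x\in\ker(A)\setminus\{0\}$. An entry $g_{ij}=1$ is interpreted as adding $x_j$ to cluster $C_i$ and $g_{ij}=-1$ as removing $x_j$ from $C_i$.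
   Formalization: The competing vectors x ∈ ker(A)∖{0} in the support-minimality condition defining circuits are taken in ℚ^(kn) rather than $\mathbb R^{kn}$. -}

module Defs where

open import Data.Nat as ℕ using (ℕ; zero; suc; _≤_)
open import Data.Nat.Divisibility using (_∣_)
open import Data.Integer as ℤ using (ℤ; +_; -[1+_]; ∣_∣)
open import Data.Rational as ℚ using (ℚ)
open import Data.Fin using (Fin; zero; suc; inject₁; fromℕ)
open import Data.Product using (Σ; ∃; ∃-syntax; _×_; _,_)
open import Data.Sum using (_⊎_)
open import Function using (_⇔_)
open import Function.Definitions using (Injective)
open import Relation.Binary.PropositionalEquality using (_≡_; _≢_)
open import Relation.Nullary using (¬_)

-- Vectors in ℝ^{kn} are represented as functions y : Fin k → Fin n → R,
-- y i j = y_{ij} (cluster i, item j).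

sumℤ : ∀ {m} → (Fin m → ℤ) → ℤ
sumℤ {zero}  f = + 0
sumℤ {suc m} f = f zero ℤ.+ sumℤ (λ t → f (suc t))

sumℚ : ∀ {m} → (Fin m → ℚ) → ℚ
sumℚ {zero}  f = ℚ.0ℚ
sumℚ {suc m} f = f zero ℚ.+ sumℚ (λ t → f (suc t))

-- x ∈ ker(A):  ∑_i x_ij = 0 for every item j
InKerℚ : ∀ {k n} → (Fin k → Fin n → ℚ) → Set
InKerℚ {k} {n} x = ∀ (j : Fin n) → sumℚ (λ i → x i j) ≡ ℚ.0ℚ

InKerℤ : ∀ {k n} → (Fin k → Fin n → ℤ) → Set
InKerℤ {k} {n} g = ∀ (j : Fin n) → sumℤ (λ i → g i j) ≡ + 0

-- Rows of the inequality system By ≤ d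
data BRow (k n : ℕ) : Set where
  lower  : Fin k → BRow k n            -- -∑_j y_ij ≤ -κ⁻_i
  upper  : Fin k → BRow k n            --  ∑_j y_ij ≤  κ⁺_i
  nonneg : Fin k → Fin n → BRow k n    --  -y_ij ≤ 0

Bmul : ∀ {k n} → (Fin k → Fin n → ℚ) → BRow k n → ℚ
Bmul x (lower i)    = ℚ.- sumℚ (λ j → x i j)
Bmul x (upper i)    = sumℚ (λ j → x i j)
Bmul x (nonneg i j) = ℚ.- x i j

SuppB : ∀ {k n} → (Fin k → Fin n → ℚ) → BRow k n → Set
SuppB x r = Bmul x r ≢ ℚ.0ℚ

toℚ : ∀ {k n} → (Fin k → Fin n → ℤ) → Fin k → Fin n → ℚ
toℚ g i j = g i j ℚ./ 1

NonZeroℚ : ∀ {k n} → (Fin k → Fin n → ℚ) → Set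
NonZeroℚ x = ∃[ i ] ∃[ j ] x i j ≢ ℚ.0ℚ

NonZeroℤ : ∀ {k n} → (Fin k → Fin n → ℤ) → Set
NonZeroℤ g = ∃[ i ] ∃[ j ] g i j ≢ + 0

CoprimeComponents : ∀ {k n} → (Fin k → Fin n → ℤ) → Set
CoprimeComponents g = ∀ (d : ℕ) → (∀ i j → d ∣ ∣ g i j ∣) → d ≡ 1

-- Circuit of PP(κ±) w.r.t. its defining system {Ay = b, By ≤ d}
-- (A and B do not depend on κ±).
IsCircuit : ∀ {k n} → (Fin k → Fin n → ℤ) → Set
IsCircuit {k} {n} g =
  InKerℤ g × NonZeroℤ g × CoprimeComponents g ×
  (∀ (x : Fin k → Fin n → ℚ) → InKerℚ x → NonZeroℚ x →
     (∀ r → SuppB x r → SuppB (toℚ g) r) →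
     (∀ r → SuppB (toℚ g) r → SuppB x r))

data Trit : ℤ → Set where
  t0  : Trit (+ 0)
  t1  : Trit (+ 1)
  t-1 : Trit (-[1+ 0 ])

ColumnOK : ∀ {k n} → (Fin k → Fin n → ℤ) → Fin n → Set
ColumnOK {k} g j =
  (∀ i → g i j ≡ + 0) ⊎
  (∃[ i ] ∃[ l ] (i ≢ l × g i j ≡ -[1+ 0 ] × g l j ≡ + 1 ×
      (∀ r → r ≢ i → r ≢ l → g r j ≡ + 0)))

Edge : ∀ {k n} → (Fin k → Fin n → ℤ) → Fin k → Fin k → Fin n → Set
Edge g i l j = g i j ≡ -[1+ 0 ] × g l j ≡ + 1

IsSinglePath : ∀ {k n} → (Fin k → Fin n → ℤ) → Set
IsSinglePath {k} {n} g =
  ∃[ m ] (1 ≤ m × Σ (Fin (suc m) → Fin k) λ v → Σ (Fin m → Fin n) λ e →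
    Injective _≡_ _≡_ v × Injective _≡_ _≡_ e ×
    (∀ i l j → Edge g i l j ⇔
       (∃[ t ] (e t ≡ j × v (inject₁ t) ≡ i × v (suc t) ≡ l))))

IsSingleCycle : ∀ {k n} → (Fin k → Fin n → ℤ) → Set
IsSingleCycle {k} {n} g =
  ∃[ m ] (1 ≤ m × Σ (Fin (suc m) → Fin k) λ v → Σ (Fin (suc m) → Fin n) λ e →
    Injective _≡_ _≡_ v × Injective _≡_ _≡_ e ×
    (∀ i l j → Edge g i l j ⇔
       ((∃[ t ] (e (inject₁ t) ≡ j × v (inject₁ t) ≡ i × v (suc t) ≡ l)) ⊎
        (e (fromℕ m) ≡ j × v (fromℕ m) ≡ i × v zero ≡ l))))

IsExchange : ∀ {k n} → (Fin k → Fin n → ℤ) → Set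
IsExchange g =
  (∀ i j → Trit (g i j)) × (∀ j → ColumnOK g j) ×
  (IsSingleCycle g ⊎ IsSinglePath g)

-- If g is the exchange vector of a single path or cycle of D(g), a kernel vector x whose B-support lies in
-- that of g vanishes off the support of g; zero column sums and zero row sums at inner vertices force x to be
-- ±α along the walk with α ≠ 0, and the end rows of a path carry a single entry, so x and g have the same
-- B-support: g is a circuit.
-- Conversely, for a circuit g, repeatedly leave a row through a negative entry and enter a row that is
-- positive in that column. Zero column and row sums keep this going until the walk closes a cycle or reaches
-- an unbalanced row; starting at an unbalanced row if there is one makes both ends of a path unbalanced.
-- The exchange vector x of this walk has B-support inside that of g, and g + g₀ x, where g₀ < 0 is the entry
-- of g at the first step, vanishes where g does not. Minimality forces g = - g₀ x, and coprimality g = x.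
module Submission where

open import Defs
open import Algebra.Bundles using (AbelianGroup; CommutativeMonoid)
import Algebra.Properties.Group as GroupProperties
open import Data.Fin as Fin using (Fin; zero; suc; toℕ; inject₁; fromℕ; fromℕ<; punchIn; punchOut)
import Data.Fin.Properties as FinP
open import Data.Integer as ℤ using (ℤ; +_; -[1+_]; ∣_∣; 0ℤ; 1ℤ; -1ℤ; _+_; _*_; -_)
import Data.Integer.Properties as ℤP
open import Data.Nat as ℕ using (ℕ; zero; suc; z≤n; s≤s; _≤_; _<_)
import Data.Nat.Coprimality as Coprimality
open import Data.Nat.Divisibility as Divisibility using (_∣_; m∣m*n)
import Data.Nat.Properties as ℕP
import Data.Nat.DivMod as DivMod
open DivMod using (_mod_)
open import Data.Product using (Σ; ∃; ∃-syntax; _×_; _,_; proj₁; proj₂)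
open import Data.Rational as ℚ using (ℚ; mkℚ)
import Data.Rational.Properties as ℚP
import Algebra.Properties.Semiring.Sum as SemiringSum
open import Data.Sum using (_⊎_; inj₁; inj₂)
open import Data.Sum.Function.Propositional using (_⊎-⇔_)
open import Function using (_⇔_; _∘_; id; mk⇔; Equivalence)
open import Function.Definitions using (Injective)
open import Function.Properties.Equivalence using () renaming (refl to ⇔-refl; sym to ⇔-sym; trans to ⇔-trans)
open import Relation.Binary using (tri<; tri≈; tri>)
open import Relation.Binary.PropositionalEquality
  using (_≡_; _≢_; refl; sym; trans; cong; cong₂; subst; module ≡-Reasoning)
open import Relation.Nullary using (¬_; Dec; yes; no; contradiction)
import Relation.Nullary.Decidable as Decidable
open Decidable using (decidable-stable; _×-dec_; _⊎-dec_; ¬?)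

open Equivalence using (to; from)

module SupportSum {c ℓ} (M : CommutativeMonoid c ℓ) where
  open CommutativeMonoid M
    using (Carrier; _≈_; _∙_; ∙-congˡ; setoid; identityʳ) renaming (ε to 0#)
  open import Algebra.Properties.CommutativeMonoid.Sum M public
  open import Relation.Binary.Reasoning.Setoid setoid

  sum-zero : ∀ {m} (f : Fin m → Carrier) → (∀ r → f r ≈ 0#) → sum f ≈ 0#
  sum-zero {m} f f≈0 = begin
    sum f                ≈⟨ sum-cong-≋ f≈0 ⟩
    sum {m} (λ _ → 0#)   ≈⟨ sum-replicate-zero m ⟩
    0#                   ∎

  sum-single : ∀ {m} (f : Fin m → Carrier) a → (∀ r → r ≢ a → f r ≈ 0#) → sum f ≈ f a
  sum-single {suc m} f a off = begin
    sum f                     ≈⟨ sum-remove f ⟩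
    f a ∙ sum (f ∘ punchIn a) ≈⟨ ∙-congˡ (sum-zero (f ∘ punchIn a) (λ r → off _ (FinP.punchInᵢ≢i a r))) ⟩
    f a ∙ 0#                  ≈⟨ identityʳ (f a) ⟩
    f a                       ∎

  sum-pair : ∀ {m} (f : Fin m → Carrier) {a b} → a ≢ b → (∀ r → r ≢ a → r ≢ b → f r ≈ 0#) →
             sum f ≈ f a ∙ f b
  sum-pair {suc m} f {a} {b} a≢b off = begin
    sum f                                ≈⟨ sum-remove f ⟩
    f a ∙ sum (f ∘ punchIn a)            ≈⟨ ∙-congˡ (sum-single (f ∘ punchIn a) (punchOut a≢b) off′) ⟩
    f a ∙ f (punchIn a (punchOut a≢b))   ≡⟨ cong (λ r → f a ∙ f r) (FinP.punchIn-punchOut a≢b) ⟩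
    f a ∙ f b                            ∎
    where
    off′ : ∀ r → r ≢ punchOut a≢b → f (punchIn a r) ≈ 0#
    off′ r r≢ = off _ (FinP.punchInᵢ≢i a r) λ eq →
      r≢ (FinP.punchIn-injective a r _ (trans eq (sym (FinP.punchIn-punchOut a≢b))))

module ℤGroup = GroupProperties (AbelianGroup.group ℤP.+-0-abelianGroup)
module ℚGroup = GroupProperties ℚP.+-0-group

≢0-stableℤ : ∀ {a : ℤ} → ¬ (a ≢ 0ℤ) → a ≡ 0ℤ
≢0-stableℤ {a} = decidable-stable (a ℤ.≟ 0ℤ)

≢0-stableℚ : ∀ {q : ℚ} → ¬ (q ≢ ℚ.0ℚ) → q ≡ ℚ.0ℚ
≢0-stableℚ {q} = decidable-stable (q ℚ.≟ ℚ.0ℚ)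

module ℤΣ = SupportSum ℤP.+-0-commutativeMonoid
module ℚΣ = SupportSum ℚP.+-0-commutativeMonoid

sumℤ≡sum : ∀ {m} (f : Fin m → ℤ) → sumℤ f ≡ ℤΣ.sum f
sumℤ≡sum {zero}  f = refl
sumℤ≡sum {suc m} f = cong (λ s → f zero + s) (sumℤ≡sum (f ∘ suc))

sumℚ≡sum : ∀ {m} (f : Fin m → ℚ) → sumℚ f ≡ ℚΣ.sum f
sumℚ≡sum {zero}  f = refl
sumℚ≡sum {suc m} f = cong (λ s → f zero ℚ.+ s) (sumℚ≡sum (f ∘ suc))

sumℤ-zero : ∀ {m} (f : Fin m → ℤ) → (∀ r → f r ≡ 0ℤ) → sumℤ f ≡ 0ℤ
sumℤ-zero f f≡0 = trans (sumℤ≡sum f) (ℤΣ.sum-zero f f≡0)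

sumℤ-pair : ∀ {m} (f : Fin m → ℤ) {a b} → a ≢ b → (∀ r → r ≢ a → r ≢ b → f r ≡ 0ℤ) → sumℤ f ≡ f a + f b
sumℤ-pair f a≢b off = trans (sumℤ≡sum f) (ℤΣ.sum-pair f a≢b off)

sumℚ-single : ∀ {m} (f : Fin m → ℚ) a → (∀ r → r ≢ a → f r ≡ ℚ.0ℚ) → sumℚ f ≡ f a
sumℚ-single f a off = trans (sumℚ≡sum f) (ℚΣ.sum-single f a off)

sumℚ-pair : ∀ {m} (f : Fin m → ℚ) {a b} → a ≢ b → (∀ r → r ≢ a → r ≢ b → f r ≡ ℚ.0ℚ) →
            sumℚ f ≡ f a ℚ.+ f b
sumℚ-pair f a≢b off = trans (sumℚ≡sum f) (ℚΣ.sum-pair f a≢b off)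

fromℤ : ℤ → ℚ
fromℤ a = a ℚ./ 1

integral : ℤ → ℚ
integral a = mkℚ a 0 (Coprimality.sym (Coprimality.1-coprimeTo ∣ a ∣))

fromℤ≡integral : ∀ a → fromℤ a ≡ integral a
fromℤ≡integral a = ℚP.↥p/↧p≡p (integral a)

fromℤ-injective : ∀ {a b} → fromℤ a ≡ fromℤ b → a ≡ b
fromℤ-injective {a} {b} eq = cong ℚ.↥_ (trans (sym (fromℤ≡integral a)) (trans eq (fromℤ≡integral b)))

fromℤ-+ : ∀ a b → fromℤ (a + b) ≡ fromℤ a ℚ.+ fromℤ b
fromℤ-+ a b = begin
  (a + b) ℚ./ 1                       ≡⟨ ℚP./-cong (sym (cong₂ _+_ (ℤP.*-identityʳ a) (ℤP.*-identityʳ b))) refl ⟩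
  (a * + 1 + b * + 1) ℚ./ (1 ℕ.* 1)   ≡⟨⟩
  integral a ℚ.+ integral b           ≡⟨ cong₂ ℚ._+_ (fromℤ≡integral a) (fromℤ≡integral b) ⟨
  fromℤ a ℚ.+ fromℤ b                 ∎
  where open ≡-Reasoning

fromℤ-neg : ∀ a → fromℤ (- a) ≡ ℚ.- fromℤ a
fromℤ-neg a = trans (fromℤ≡integral (- a)) (trans (neg-integral a) (cong ℚ.-_ (sym (fromℤ≡integral a))))
  where
  neg-integral : ∀ a → integral (- a) ≡ ℚ.- integral a
  neg-integral (+ zero)  = refl
  neg-integral (+ suc _) = refl
  neg-integral -[1+ _ ]  = refl

fromℤ-sum : ∀ {m} (f : Fin m → ℤ) → fromℤ (sumℤ f) ≡ sumℚ (fromℤ ∘ f)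
fromℤ-sum {zero}  f = refl
fromℤ-sum {suc m} f =
  trans (fromℤ-+ (f zero) _) (cong (λ s → fromℤ (f zero) ℚ.+ s) (fromℤ-sum (f ∘ suc)))

Bmulℤ : ∀ {k n} → (Fin k → Fin n → ℤ) → BRow k n → ℤ
Bmulℤ h (lower i)    = - sumℤ (h i)
Bmulℤ h (upper i)    = sumℤ (h i)
Bmulℤ h (nonneg i j) = - h i j

SuppBℤ : ∀ {k n} → (Fin k → Fin n → ℤ) → BRow k n → Set
SuppBℤ h r = Bmulℤ h r ≢ 0ℤ

Bmul-toℚ : ∀ {k n} (h : Fin k → Fin n → ℤ) r → Bmul (toℚ h) r ≡ fromℤ (Bmulℤ h r)
Bmul-toℚ h (lower i)    = trans (cong ℚ.-_ (sym (fromℤ-sum (h i)))) (sym (fromℤ-neg (sumℤ (h i))))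
Bmul-toℚ h (upper i)    = sym (fromℤ-sum (h i))
Bmul-toℚ h (nonneg i j) = sym (fromℤ-neg (h i j))

SuppB-toℚ : ∀ {k n} (h : Fin k → Fin n → ℤ) r → SuppB (toℚ h) r ⇔ SuppBℤ h r
SuppB-toℚ h r = mk⇔
  (λ s eq → s (trans (Bmul-toℚ h r) (cong fromℤ eq)))
  (λ s eq → s (fromℤ-injective (trans (sym (Bmul-toℚ h r)) eq)))

InKerℤ⇒InKerℚ : ∀ {k n} (h : Fin k → Fin n → ℤ) → InKerℤ h → InKerℚ (toℚ h)
InKerℤ⇒InKerℚ h ker j = trans (sym (fromℤ-sum (λ i → h i j))) (cong fromℤ (ker j))

NonZeroℤ⇒NonZeroℚ : ∀ {k n} (h : Fin k → Fin n → ℤ) → NonZeroℤ h → NonZeroℚ (toℚ h)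
NonZeroℤ⇒NonZeroℚ h (i , j , hij≢0) = i , j , hij≢0 ∘ fromℤ-injective

circuit-minimal : ∀ {k n} {g : Fin k → Fin n → ℤ} → IsCircuit g →
                  ∀ h → InKerℤ h → NonZeroℤ h → (∀ r → SuppBℤ h r → SuppBℤ g r) →
                  ∀ r → SuppBℤ g r → SuppBℤ h r
circuit-minimal {g = g} (_ , _ , _ , minimal) h ker nz h⊆g r gr =
  to (SuppB-toℚ h r)
    (minimal (toℚ h) (InKerℤ⇒InKerℚ h ker) (NonZeroℤ⇒NonZeroℚ h nz)
      (λ r′ → from (SuppB-toℚ g r′) ∘ h⊆g r′ ∘ to (SuppB-toℚ h r′))
      r (from (SuppB-toℚ g r) gr))

sumℤ-linear : ∀ {m} (c : ℤ) (f f′ : Fin m → ℤ) →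
              sumℤ (λ r → f r + c * f′ r) ≡ sumℤ f + c * sumℤ f′
sumℤ-linear c f f′ = begin
  sumℤ (λ r → f r + c * f′ r)          ≡⟨ sumℤ≡sum (λ r → f r + c * f′ r) ⟩
  ℤΣ.sum (λ r → f r + c * f′ r)        ≡⟨ ℤΣ.∑-distrib-+ f _ ⟩
  ℤΣ.sum f + ℤΣ.sum (λ r → c * f′ r)   ≡⟨ cong (λ s → ℤΣ.sum f + s) (sym (Semiring.*-distribˡ-sum c f′)) ⟩
  ℤΣ.sum f + c * ℤΣ.sum f′             ≡⟨ cong₂ (λ s s′ → s + c * s′) (sumℤ≡sum f) (sumℤ≡sum f′) ⟨
  sumℤ f + c * sumℤ f′                 ∎
  where
  open ≡-Reasoning
  module Semiring = SemiringSum ℤP.+-*-semiring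

neg-linear : ∀ c a b → - (a + c * b) ≡ - a + c * - b
neg-linear c a b = trans (ℤP.neg-distrib-+ a (c * b)) (cong (λ s → - a + s) (ℤP.neg-distribʳ-* c b))

Bmulℤ-linear : ∀ {k n} (c : ℤ) (h h′ : Fin k → Fin n → ℤ) r →
               Bmulℤ (λ i j → h i j + c * h′ i j) r ≡ Bmulℤ h r + c * Bmulℤ h′ r
Bmulℤ-linear c h h′ (lower i)    =
  trans (cong -_ (sumℤ-linear c (h i) (h′ i))) (neg-linear c (sumℤ (h i)) (sumℤ (h′ i)))
Bmulℤ-linear c h h′ (upper i)    = sumℤ-linear c (h i) (h′ i)
Bmulℤ-linear c h h′ (nonneg i j) = neg-linear c (h i j) (h′ i j)

module _ {k n} {g : Fin k → Fin n → ℤ} (circuit : IsCircuit g) (h : Fin k → Fin n → ℤ)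
         (ker-h : InKerℤ h) (h⊆g : ∀ r → SuppBℤ h r → SuppBℤ g r) {i₀ j₀} (h₀ : h i₀ j₀ ≡ -1ℤ) where

  private
    a : ℤ
    a = g i₀ j₀

    -- z vanishes at (i₀, j₀), where g does not, and supp (B z) ⊆ supp (B g), so minimality of g forces z = 0
    z : Fin k → Fin n → ℤ
    z i j = g i j + a * h i j

    0+a*0≡0 : 0ℤ + a * 0ℤ ≡ 0ℤ
    0+a*0≡0 = trans (ℤP.+-identityˡ (a * 0ℤ)) (ℤP.*-zeroʳ a)

    ker-z : InKerℤ z
    ker-z j = begin
      sumℤ (λ i → g i j + a * h i j)               ≡⟨ sumℤ-linear a (λ i → g i j) (λ i → h i j) ⟩
      sumℤ (λ i → g i j) + a * sumℤ (λ i → h i j)  ≡⟨ cong₂ (λ s t → s + a * t) (proj₁ circuit j) (ker-h j) ⟩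
      0ℤ + a * 0ℤ                                  ≡⟨ 0+a*0≡0 ⟩
      0ℤ                                           ∎
      where open ≡-Reasoning

    a≢0 : a ≢ 0ℤ
    a≢0 a≡0 = h⊆g (nonneg i₀ j₀) (subst (λ v → - v ≢ 0ℤ) (sym h₀) (λ ())) (cong -_ a≡0)

    z⊆g : ∀ r → SuppBℤ z r → SuppBℤ g r
    z⊆g r zr gr≡0 = zr (begin
      Bmulℤ z r                    ≡⟨ Bmulℤ-linear a g h r ⟩
      Bmulℤ g r + a * Bmulℤ h r    ≡⟨ cong₂ (λ s t → s + a * t) gr≡0 hr≡0 ⟩
      0ℤ + a * 0ℤ                  ≡⟨ 0+a*0≡0 ⟩
      0ℤ                           ∎)
      where
      open ≡-Reasoning
      hr≡0 : Bmulℤ h r ≡ 0ℤ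
      hr≡0 = ≢0-stableℤ λ hr → h⊆g r hr gr≡0

    z₀ : z i₀ j₀ ≡ 0ℤ
    z₀ = begin
      a + a * h i₀ j₀   ≡⟨ cong (λ t → a + a * t) h₀ ⟩
      a + a * -1ℤ       ≡⟨ cong (λ t → a + t) (trans (ℤP.*-comm a -1ℤ) (ℤP.-1*i≡-i a)) ⟩
      a + - a           ≡⟨ ℤP.+-inverseʳ a ⟩
      0ℤ                ∎
      where open ≡-Reasoning

    z≡0 : ∀ i j → z i j ≡ 0ℤ
    z≡0 i j = ≢0-stableℤ λ zij≢0 →
      circuit-minimal circuit z ker-z (i , j , zij≢0) z⊆g (nonneg i₀ j₀) (a≢0 ∘ ℤP.neg-injective) (cong -_ z₀)

  circuit-multiple : ∀ i j → g i j ≡ - a * h i j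
  circuit-multiple i j =
    trans (ℤGroup.inverseˡ-unique (g i j) (a * h i j) (z≡0 i j)) (ℤP.neg-distribˡ-* a (h i j))

coprime-multiple : ∀ {k n} {g h : Fin k → Fin n → ℤ} {c} → CoprimeComponents g →
                   (∀ i j → g i j ≡ c * h i j) → ∣ c ∣ ≡ 1
coprime-multiple {h = h} {c} coprime g≡ch = coprime ∣ c ∣ λ i j →
  subst (∣ c ∣ ∣_) (sym (trans (cong ∣_∣ (g≡ch i j)) (ℤP.abs-* c (h i j)))) (m∣m*n ∣ h i j ∣)

circuit-unique : ∀ {k n} {g : Fin k → Fin n → ℤ} → IsCircuit g →
                 ∀ h → InKerℤ h → (∀ r → SuppBℤ h r → SuppBℤ g r) →
                 ∀ {i₀ j₀} → h i₀ j₀ ≡ -1ℤ → g i₀ j₀ ℤ.< 0ℤ → ∀ i j → g i j ≡ h i j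
circuit-unique {g = g} circuit h ker-h h⊆g {i₀} {j₀} h₀ g₀<0 i j = begin
  g i j               ≡⟨ g≡ch i j ⟩
  - g i₀ j₀ * h i j   ≡⟨ cong (_* h i j) -g₀≡1 ⟩
  1ℤ * h i j          ≡⟨ ℤP.*-identityˡ (h i j) ⟩
  h i j               ∎
  where
  open ≡-Reasoning
  g≡ch : ∀ i j → g i j ≡ - g i₀ j₀ * h i j
  g≡ch = circuit-multiple circuit h ker-h h⊆g h₀
  -g₀≡1 : - g i₀ j₀ ≡ 1ℤ
  -g₀≡1 = trans (sym (ℤP.0≤i⇒+∣i∣≡i (ℤP.<⇒≤ (ℤP.neg-mono-< g₀<0))))
                (cong +_ (coprime-multiple {h = h} {c = - g i₀ j₀} (proj₁ (proj₂ (proj₂ circuit))) g≡ch))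

∃-⇔ : ∀ {A : Set} {P Q : A → Set} → (∀ x → P x ⇔ Q x) → ∃ P ⇔ ∃ Q
∃-⇔ P⇔Q = mk⇔ (λ (x , px) → x , to (P⇔Q x) px) (λ (x , qx) → x , from (P⇔Q x) qx)

∃Fin⇔∃< : ∀ {m} (P : ℕ → Set) → (∃[ t ] P (toℕ {m} t)) ⇔ (∃[ u ] (u < m × P u))
∃Fin⇔∃< P = mk⇔ (λ (t , pt) → toℕ t , FinP.toℕ<n t , pt)
                (λ (u , u<m , pu) → fromℕ< u<m , subst P (sym (FinP.toℕ-fromℕ< u<m)) pu)

∃<1+⇔ : ∀ {m} (P : ℕ → Set) → (∃[ u ] (u < suc m × P u)) ⇔ ((∃[ u ] (u < m × P u)) ⊎ P m)
∃<1+⇔ {m} P =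
  mk⇔ split Data.Sum.[ (λ (u , u<m , pu) → u , ℕP.m<n⇒m<1+n u<m , pu) , (λ pm → m , ℕP.n<1+n m , pm) ]
  where
  split : ∃[ u ] (u < suc m × P u) → (∃[ u ] (u < m × P u)) ⊎ P m
  split (u , u<1+m , pu) with ℕP.m≤n⇒m<n∨m≡n (ℕP.≤-pred u<1+m)
  ... | inj₁ u<m  = inj₁ (u , u<m , pu)
  ... | inj₂ refl = inj₂ pu

≡×≡×≡-⇔ : ∀ {A B C : Set} {a a′ x : A} {b b′ y : B} {c c′ z : C} → a ≡ a′ → b ≡ b′ → c ≡ c′ →
          (a ≡ x × b ≡ y × c ≡ z) ⇔ (a′ ≡ x × b′ ≡ y × c′ ≡ z)
≡×≡×≡-⇔ refl refl refl = ⇔-refl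

-- Vertices V 0, …, V m are distinct and step u < p goes from V u to V (suc u) through item E u:
-- a path has p = m steps, a cycle one more step leading back to V 0.
record SimpleWalk (k n : ℕ) : Set where
  field
    m p         : ℕ
    V           : ℕ → Fin k
    E           : ℕ → Fin n
    1≤m         : 1 ≤ m
    shape       : p ≡ m ⊎ (p ≡ suc m × V (suc m) ≡ V 0)
    V-injective : ∀ {a b} → a ≤ m → b ≤ m → V a ≡ V b → a ≡ b
    E-injective : ∀ {a b} → a < p → b < p → E a ≡ E b → a ≡ b

module _ {k n} (W : SimpleWalk k n) where
  open SimpleWalk W

  StepOf : Fin k → Fin k → Fin n → Set
  StepOf i l j = ∃[ u ] (u < p × E u ≡ j × V u ≡ i × V (suc u) ≡ l)

  m≤p : m ≤ p
  m≤p with shape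
  ... | inj₁ refl       = ℕP.≤-refl
  ... | inj₂ (refl , _) = ℕP.n≤1+n m

  0<p : 0 < p
  0<p = ℕP.<-≤-trans 1≤m m≤p

  <p⇒≤m : ∀ {u} → u < p → u ≤ m
  <p⇒≤m u<p with shape
  ... | inj₁ refl       = ℕP.<⇒≤ u<p
  ... | inj₂ (refl , _) = ℕP.≤-pred u<p

  step-target : ∀ {u} → u < p → suc u ≤ m ⊎ (p ≡ suc m × u ≡ m × V (suc u) ≡ V 0)
  step-target {u} u<p with ℕP.m≤n⇒m<n∨m≡n (<p⇒≤m u<p) | shape
  ... | inj₁ u<m  | _                     = inj₁ u<m
  ... | inj₂ refl | inj₁ refl             = contradiction u<p (ℕP.<-irrefl refl)
  ... | inj₂ refl | inj₂ (p≡1+m , closes) = inj₂ (p≡1+m , refl , closes)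

  vertex? : ∀ i → Dec (∃[ a ] (a < suc m × V a ≡ i))
  vertex? i = Decidable.map (∃Fin⇔∃< (λ a → V a ≡ i)) (FinP.any? λ t → V (toℕ t) Fin.≟ i)

  step-moves : ∀ {u} → u < p → V u ≢ V (suc u)
  step-moves {u} u<p eq with step-target u<p
  ... | inj₁ 1+u≤m = ℕP.1+n≢n (sym (V-injective (<p⇒≤m u<p) 1+u≤m eq))
  ... | inj₂ (_ , refl , closes) = ℕP.<-irrefl (sym (V-injective ℕP.≤-refl z≤n (trans eq closes))) 1≤m

record IsExchangeAlong {k n} (h : Fin k → Fin n → ℤ) (W : SimpleWalk k n) : Set where
  field
    columns : ∀ j → ColumnOK h j
    steps   : ∀ i l j → Edge h i l j ⇔ StepOf W i l j

ColumnOK⇒InKerℤ : ∀ {k n} {h : Fin k → Fin n → ℤ} → (∀ j → ColumnOK h j) → InKerℤ h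
ColumnOK⇒InKerℤ {h = h} column j with column j
... | inj₁ h·j≡0                         = sumℤ-zero (λ r → h r j) h·j≡0
... | inj₂ (i , l , i≢l , hi , hl , off) = trans (sumℤ-pair (λ r → h r j) i≢l off) (cong₂ _+_ hi hl)

module ExchangeAlong {k n} {h : Fin k → Fin n → ℤ} {W : SimpleWalk k n} (along : IsExchangeAlong h W) where
  open SimpleWalk W
  open IsExchangeAlong along

  step-values : ∀ {u} → u < p → h (V u) (E u) ≡ -1ℤ × h (V (suc u)) (E u) ≡ 1ℤ
  step-values {u} u<p = from (steps _ _ _) (u , u<p , refl , refl , refl)

  support-on-step : ∀ {i j} → h i j ≢ 0ℤ → ∃[ u ] (u < p × E u ≡ j × (V u ≡ i ⊎ V (suc u) ≡ i))
  support-on-step {i} {j} hij≢0 with columns j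
  ... | inj₁ h·j≡0 = contradiction (h·j≡0 i) hij≢0
  ... | inj₂ (i′ , l′ , _ , hi′ , hl′ , off)
    with u , u<p , Eu , Vu , V1+u ← to (steps i′ l′ j) (hi′ , hl′)
    with i Fin.≟ i′ | i Fin.≟ l′
  ... | yes refl | _        = u , u<p , Eu , inj₁ Vu
  ... | no _     | yes refl = u , u<p , Eu , inj₂ V1+u
  ... | no i≢i′  | no i≢l′  = contradiction (off i i≢i′ i≢l′) hij≢0

  column-off-step : ∀ {u r} → u < p → r ≢ V u → r ≢ V (suc u) → h r (E u) ≡ 0ℤ
  column-off-step {u} {r} u<p r≢Vu r≢V1+u = ≢0-stableℤ λ hr≢0 → off-step (support-on-step hr≢0)
    where
    off-step : ¬ (∃[ u′ ] (u′ < p × E u′ ≡ E u × (V u′ ≡ r ⊎ V (suc u′) ≡ r)))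
    off-step (u′ , u′<p , Eu′≡Eu , ends) with E-injective u′<p u<p Eu′≡Eu | ends
    ... | refl | inj₁ Vu≡r   = r≢Vu (sym Vu≡r)
    ... | refl | inj₂ V1+u≡r = r≢V1+u (sym V1+u≡r)

  row-support : ∀ {a j} → a ≤ m → h (V a) j ≢ 0ℤ →
                (a < p × E a ≡ j) ⊎ (∃[ q ] (suc q ≡ a × E q ≡ j)) ⊎ (p ≡ suc m × a ≡ 0 × E m ≡ j)
  row-support {a} a≤m ha≢0 with support-on-step ha≢0
  ... | u , u<p , Eu , inj₁ Vu≡Va with V-injective (<p⇒≤m W u<p) a≤m Vu≡Va
  ...   | refl = inj₁ (u<p , Eu)
  row-support {a} a≤m ha≢0 | u , u<p , Eu , inj₂ V1+u≡Va with step-target W u<p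
  ... | inj₁ 1+u≤m                = inj₂ (inj₁ (u , V-injective 1+u≤m a≤m V1+u≡Va , Eu))
  ... | inj₂ (p≡ , refl , closes) = inj₂ (inj₂ (p≡ , V-injective a≤m z≤n (trans (sym V1+u≡Va) closes) , Eu))

  row-off-walk : ∀ {i j} → ¬ (∃[ a ] (a < suc m × V a ≡ i)) → h i j ≡ 0ℤ
  row-off-walk {i} {j} off = ≢0-stableℤ (on-walk ∘ support-on-step)
    where
    on-walk : ¬ (∃[ u ] (u < p × E u ≡ j × (V u ≡ i ⊎ V (suc u) ≡ i)))
    on-walk (u , u<p , _ , inj₁ Vu≡i) = off (u , s≤s (<p⇒≤m W u<p) , Vu≡i)
    on-walk (u , u<p , _ , inj₂ V1+u≡i) with step-target W u<p
    ... | inj₁ 1+u≤m            = off (suc u , s≤s 1+u≤m , V1+u≡i)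
    ... | inj₂ (_ , _ , closes) = off (0 , s≤s z≤n , trans (sym closes) V1+u≡i)

  row-sum-two-steps : ∀ {i o q} → o < p → q < p → o ≢ q → V o ≡ i → V (suc q) ≡ i →
                      (∀ {j} → h i j ≢ 0ℤ → j ≡ E o ⊎ j ≡ E q) → sumℤ (h i) ≡ 0ℤ
  row-sum-two-steps {o = o} {q} o<p q<p o≢q refl V1+q≡Vo support =
    trans (sumℤ-pair (h (V o)) (o≢q ∘ E-injective o<p q<p) off)
          (cong₂ _+_ (proj₁ (step-values o<p))
                     (subst (λ v → h v (E q) ≡ 1ℤ) V1+q≡Vo (proj₂ (step-values q<p))))
    where
    off : ∀ r → r ≢ E o → r ≢ E q → h (V o) r ≡ 0ℤ
    off r r≢Eo r≢Eq = ≢0-stableℤ λ hr≢0 → Data.Sum.[ r≢Eo , r≢Eq ] (support hr≢0)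

  inner-row-support : ∀ {q j} → suc q ≤ m → h (V (suc q)) j ≢ 0ℤ → j ≡ E (suc q) ⊎ j ≡ E q
  inner-row-support 1+q≤m h≢0 with row-support 1+q≤m h≢0
  ... | inj₁ (_ , E≡j)               = inj₁ (sym E≡j)
  ... | inj₂ (inj₁ (_ , refl , E≡j)) = inj₂ (sym E≡j)
  ... | inj₂ (inj₂ (_ , () , _))

  row-sum-inner : ∀ {a} → a ≤ m → (p ≡ m → 0 < a × a < m) → sumℤ (h (V a)) ≡ 0ℤ
  row-sum-inner {zero} _ inner with shape
  ... | inj₁ p≡m = contradiction (proj₁ (inner p≡m)) (λ ())
  ... | inj₂ (refl , closes) = row-sum-two-steps (s≤s z≤n) (ℕP.n<1+n m) 0≢m refl closes support
    where
    0≢m : 0 ≢ m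
    0≢m 0≡m = ℕP.<-irrefl 0≡m 1≤m
    support : ∀ {j} → h (V 0) j ≢ 0ℤ → j ≡ E 0 ⊎ j ≡ E m
    support h≢0 with row-support z≤n h≢0
    ... | inj₁ (_ , E0≡j)            = inj₁ (sym E0≡j)
    ... | inj₂ (inj₁ (_ , () , _))
    ... | inj₂ (inj₂ (_ , _ , Em≡j)) = inj₂ (sym Em≡j)
  row-sum-inner {suc q} 1+q≤m inner =
    row-sum-two-steps 1+q<p (ℕP.<-trans (ℕP.n<1+n q) 1+q<p) (ℕP.1+n≢n) refl refl (inner-row-support 1+q≤m)
    where
    1+q<p : suc q < p
    1+q<p with shape
    ... | inj₁ p≡m       = subst (suc q <_) (sym p≡m) (proj₂ (inner p≡m))
    ... | inj₂ (refl , _) = s≤s 1+q≤m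

  row-sum-nonzero⇒endpoint : ∀ {i} → sumℤ (h i) ≢ 0ℤ → p ≡ m × (i ≡ V 0 ⊎ i ≡ V m)
  row-sum-nonzero⇒endpoint {i} sum≢0 with vertex? W i
  ... | no off = contradiction (sumℤ-zero (h i) λ _ → row-off-walk off) sum≢0
  ... | yes (a , a<1+m , refl) with ℕP.≤-pred a<1+m | shape
  ...   | a≤m | inj₂ (p≡1+m , _) =
    contradiction (row-sum-inner a≤m λ p≡m → contradiction (trans (sym p≡1+m) p≡m) ℕP.1+n≢n) sum≢0
  ...   | a≤m | inj₁ p≡m with a ℕ.≟ 0 | a ℕ.≟ m
  ...     | yes refl | _        = p≡m , inj₁ refl
  ...     | no _     | yes refl = p≡m , inj₂ refl
  ...     | no a≢0   | no a≢m   =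
    contradiction (row-sum-inner a≤m λ _ → ℕP.n≢0⇒n>0 a≢0 , ℕP.≤∧≢⇒< a≤m a≢m) sum≢0

  row-sum-nonzero⇒single-step : ∀ {i} → sumℤ (h i) ≢ 0ℤ →
                                ∃[ u ] (u < p × h i (E u) ≢ 0ℤ × (∀ {j} → h i j ≢ 0ℤ → j ≡ E u))
  row-sum-nonzero⇒single-step sum≢0 with row-sum-nonzero⇒endpoint sum≢0
  ... | p≡m , inj₁ refl = 0 , 0<p W , -1≢0 ∘ trans (sym (proj₁ (step-values (0<p W)))) , support
    where
    -1≢0 : -1ℤ ≢ 0ℤ
    -1≢0 ()
    support : ∀ {j} → h (V 0) j ≢ 0ℤ → j ≡ E 0
    support h≢0 with row-support z≤n h≢0
    ... | inj₁ (_ , E0≡j)              = sym E0≡j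
    ... | inj₂ (inj₁ (_ , () , _))
    ... | inj₂ (inj₂ (p≡1+m , _ , _))  = contradiction (trans (sym p≡1+m) p≡m) ℕP.1+n≢n
  ... | p≡m , inj₂ refl = u , u<p , 1≢0 ∘ trans (sym V1+u-value) , support
    where
    u : ℕ
    u = ℕ.pred m
    1+u≡m : suc u ≡ m
    1+u≡m = ℕP.suc-pred m {{ℕ.>-nonZero 1≤m}}
    u<p : u < p
    u<p = subst (u <_) (trans 1+u≡m (sym p≡m)) (ℕP.n<1+n u)
    1≢0 : 1ℤ ≢ 0ℤ
    1≢0 ()
    V1+u-value : h (V m) (E u) ≡ 1ℤ
    V1+u-value = subst (λ a → h (V a) (E u) ≡ 1ℤ) 1+u≡m (proj₂ (step-values u<p))
    support : ∀ {j} → h (V m) j ≢ 0ℤ → j ≡ E u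
    support h≢0 with row-support ℕP.≤-refl h≢0
    ... | inj₁ (m<p , _)                = contradiction (sym p≡m) (ℕP.<⇒≢ m<p)
    ... | inj₂ (inj₁ (q , 1+q≡m , Eq≡j)) =
      trans (sym Eq≡j) (cong E (ℕP.suc-injective (trans 1+q≡m (sym 1+u≡m))))
    ... | inj₂ (inj₂ (p≡1+m , _ , _))   = contradiction (trans (sym p≡1+m) p≡m) ℕP.1+n≢n

-- Exchange vectors are circuits

negℚ≢0 : ∀ {q} → q ≢ ℚ.0ℚ → ℚ.- q ≢ ℚ.0ℚ
negℚ≢0 q≢0 = q≢0 ∘ ℚP.neg-injective

module _ {k n} {g : Fin k → Fin n → ℤ} {W : SimpleWalk k n} (along : IsExchangeAlong g W)
         (x : Fin k → Fin n → ℚ) (ker-x : InKerℚ x) (nz-x : NonZeroℚ x)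
         (x⊆g : ∀ r → SuppB x r → SuppB (toℚ g) r) where
  open SimpleWalk W
  open ExchangeAlong along

  private
    x-vanishes : ∀ {i j} → g i j ≡ 0ℤ → x i j ≡ ℚ.0ℚ
    x-vanishes {i} {j} gij≡0 = ≢0-stableℚ λ xij≢0 →
      to (SuppB-toℚ g (nonneg i j)) (x⊆g (nonneg i j) (negℚ≢0 xij≢0)) (cong -_ gij≡0)

    x-row-sum-vanishes : ∀ {i} → sumℤ (g i) ≡ 0ℤ → sumℚ (x i) ≡ ℚ.0ℚ
    x-row-sum-vanishes {i} gi≡0 = ≢0-stableℚ λ xi≢0 →
      to (SuppB-toℚ g (upper i)) (x⊆g (upper i) xi≢0) gi≡0

    -- zero column sums and zero inner row sums make x equal to - α 0 and α 0 at the tail and head of each step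
    α : ℕ → ℚ
    α u = x (V (suc u)) (E u)

    x-column : ∀ {u} → u < p → x (V u) (E u) ℚ.+ α u ≡ ℚ.0ℚ
    x-column {u} u<p = trans
      (sym (sumℚ-pair (λ r → x r (E u)) (step-moves W u<p) λ r r≢Vu r≢V1+u →
        x-vanishes (column-off-step u<p r≢Vu r≢V1+u)))
      (ker-x (E u))

    x-inner-row : ∀ {u} → suc u < p → x (V (suc u)) (E (suc u)) ℚ.+ α u ≡ ℚ.0ℚ
    x-inner-row {u} 1+u<p = trans
      (sym (sumℚ-pair (x (V (suc u))) (ℕP.1+n≢n ∘ E-injective 1+u<p (ℕP.<-trans (ℕP.n<1+n u) 1+u<p)) off))
      (x-row-sum-vanishes (row-sum-inner 1+u≤m λ p≡m → s≤s z≤n , subst (suc u <_) p≡m 1+u<p))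
      where
      1+u≤m : suc u ≤ m
      1+u≤m = <p⇒≤m W 1+u<p
      off : ∀ r → r ≢ E (suc u) → r ≢ E u → x (V (suc u)) r ≡ ℚ.0ℚ
      off r r≢E1+u r≢Eu = x-vanishes (≢0-stableℤ λ g≢0 →
        Data.Sum.[ r≢E1+u , r≢Eu ] (inner-row-support 1+u≤m g≢0))

    α-constant : ∀ {u} → u < p → α u ≡ α 0
    α-constant {zero}  _     = refl
    α-constant {suc u} 1+u<p = begin
      α (suc u)                      ≡⟨ ℚGroup.inverseʳ-unique _ _ (x-column 1+u<p) ⟩
      ℚ.- x (V (suc u)) (E (suc u))  ≡⟨ cong ℚ.-_ (ℚGroup.inverseˡ-unique _ _ (x-inner-row 1+u<p)) ⟩
      ℚ.- ℚ.- α u                    ≡⟨ ℚGroup.⁻¹-involutive (α u) ⟩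
      α u                            ≡⟨ α-constant (ℕP.<-trans (ℕP.n<1+n u) 1+u<p) ⟩
      α 0                            ∎
      where open ≡-Reasoning

    x-on-support : ∀ {i j} → g i j ≢ 0ℤ → x i j ≡ ℚ.- α 0 ⊎ x i j ≡ α 0
    x-on-support g≢0 with support-on-step g≢0
    ... | u , u<p , refl , inj₁ refl =
      inj₁ (trans (ℚGroup.inverseˡ-unique _ _ (x-column u<p)) (cong ℚ.-_ (α-constant u<p)))
    ... | u , u<p , refl , inj₂ refl = inj₂ (α-constant u<p)

    α₀≢0 : α 0 ≢ ℚ.0ℚ
    α₀≢0 α₀≡0 = proj₂ (proj₂ nz-x) (x-zero _ _)
      where
      x-zero : ∀ i j → x i j ≡ ℚ.0ℚ
      x-zero i j with g i j ℤ.≟ 0ℤ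
      ... | yes gij≡0 = x-vanishes gij≡0
      ... | no gij≢0 with x-on-support gij≢0
      ...   | inj₁ x≡-α₀ = trans x≡-α₀ (cong ℚ.-_ α₀≡0)
      ...   | inj₂ x≡α₀  = trans x≡α₀ α₀≡0

    x-nonzero-on-support : ∀ {i j} → g i j ≢ 0ℤ → x i j ≢ ℚ.0ℚ
    x-nonzero-on-support g≢0 with x-on-support g≢0
    ... | inj₁ x≡-α₀ = negℚ≢0 α₀≢0 ∘ trans (sym x≡-α₀)
    ... | inj₂ x≡α₀  = α₀≢0 ∘ trans (sym x≡α₀)

    x-row-sum-nonzero : ∀ {i} → sumℤ (g i) ≢ 0ℤ → sumℚ (x i) ≢ ℚ.0ℚ
    x-row-sum-nonzero {i} gi≢0 with row-sum-nonzero⇒single-step gi≢0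
    ... | u , _ , g≢0 , support = x-nonzero-on-support g≢0 ∘ trans (sym (sumℚ-single (x i) (E u) off))
      where
      off : ∀ r → r ≢ E u → x i r ≡ ℚ.0ℚ
      off r r≢Eu = x-vanishes (≢0-stableℤ (r≢Eu ∘ support))

  exchange-minimal : ∀ r → SuppB (toℚ g) r → SuppB x r
  exchange-minimal (lower i) s = negℚ≢0 (x-row-sum-nonzero (to (SuppB-toℚ g (lower i)) s ∘ cong -_))
  exchange-minimal (upper i) s = x-row-sum-nonzero (to (SuppB-toℚ g (upper i)) s)
  exchange-minimal (nonneg i j) s = negℚ≢0 (x-nonzero-on-support (to (SuppB-toℚ g (nonneg i j)) s ∘ cong -_))

exchangeAlong⇒IsCircuit : ∀ {k n} {g : Fin k → Fin n → ℤ} {W} → IsExchangeAlong g W → IsCircuit g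
exchangeAlong⇒IsCircuit {g = g} {W} along =
  ColumnOK⇒InKerℤ (IsExchangeAlong.columns along) , (V 0 , E 0 , λ g₀≡0 → -1≢0 (trans (sym g₀) g₀≡0)) ,
  (λ d d∣g → Divisibility.∣1⇒≡1 (subst (d ∣_) (cong ∣_∣ g₀) (d∣g (V 0) (E 0)))) ,
  λ x ker-x nz-x x⊆g → exchange-minimal along x ker-x nz-x x⊆g
  where
  open SimpleWalk W
  g₀ : g (V 0) (E 0) ≡ -1ℤ
  g₀ = proj₁ (ExchangeAlong.step-values along (0<p W))
  -1≢0 : -1ℤ ≢ 0ℤ
  -1≢0 ()

toℕ-restriction-inject₁ : ∀ {A : Set} {m} (f : ℕ → A) {g : Fin (suc m) → A} →
                          (∀ t → f (toℕ t) ≡ g t) → ∀ t → f (toℕ t) ≡ g (inject₁ t)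
toℕ-restriction-inject₁ f f≡g t = trans (cong f (sym (FinP.toℕ-inject₁ t))) (f≡g (inject₁ t))

module _ {k n} (V : ℕ → Fin k) (E : ℕ → Fin n) {i l : Fin k} {j : Fin n} where
  private
    StepAt : ℕ → Set
    StepAt u = E u ≡ j × V u ≡ i × V (suc u) ≡ l

  restricted-steps⇔ : ∀ {m} {v₀ v₁ : Fin m → Fin k} {e : Fin m → Fin n} →
                      (∀ t → E (toℕ t) ≡ e t) → (∀ t → V (toℕ t) ≡ v₀ t) → (∀ t → V (suc (toℕ t)) ≡ v₁ t) →
                      (∃[ t ] (e t ≡ j × v₀ t ≡ i × v₁ t ≡ l)) ⇔ (∃[ u ] (u < m × StepAt u))
  restricted-steps⇔ E≡e V≡v₀ V≡v₁ =
    ⇔-trans (∃-⇔ λ t → ≡×≡×≡-⇔ (sym (E≡e t)) (sym (V≡v₀ t)) (sym (V≡v₁ t))) (∃Fin⇔∃< StepAt)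

  path-steps⇔ : ∀ {m} {v : Fin (suc m) → Fin k} {e : Fin m → Fin n} →
                (∀ t → V (toℕ t) ≡ v t) → (∀ t → E (toℕ t) ≡ e t) →
                (∃[ t ] (e t ≡ j × v (inject₁ t) ≡ i × v (suc t) ≡ l)) ⇔ (∃[ u ] (u < m × StepAt u))
  path-steps⇔ V≡v E≡e = restricted-steps⇔ E≡e (toℕ-restriction-inject₁ V V≡v) (V≡v ∘ suc)

  cycle-steps⇔ : ∀ {m} {v : Fin (suc m) → Fin k} {e : Fin (suc m) → Fin n} →
                 (∀ t → V (toℕ t) ≡ v t) → (∀ t → E (toℕ t) ≡ e t) → V (suc m) ≡ V 0 →
                 ((∃[ t ] (e (inject₁ t) ≡ j × v (inject₁ t) ≡ i × v (suc t) ≡ l)) ⊎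
                  (e (fromℕ m) ≡ j × v (fromℕ m) ≡ i × v zero ≡ l))
                 ⇔ (∃[ u ] (u < suc m × StepAt u))
  cycle-steps⇔ {m} V≡v E≡e closes = ⇔-trans
    (restricted-steps⇔ (toℕ-restriction-inject₁ E E≡e) (toℕ-restriction-inject₁ V V≡v) (V≡v ∘ suc)
      ⊎-⇔ ≡×≡×≡-⇔ (sym (at-fromℕ E E≡e)) (sym (at-fromℕ V V≡v)) (sym (trans closes (V≡v zero))))
    (⇔-sym (∃<1+⇔ StepAt))
    where
    at-fromℕ : ∀ {A : Set} (f : ℕ → A) {g : Fin (suc m) → A} → (∀ t → f (toℕ t) ≡ g t) → f m ≡ g (fromℕ m)
    at-fromℕ f f≡g = trans (cong f (sym (FinP.toℕ-fromℕ m))) (f≡g (fromℕ m))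

exchangeAlong⇒IsExchange : ∀ {k n} {h : Fin k → Fin n → ℤ} {W : SimpleWalk k n} →
                           (∀ i j → Trit (h i j)) → IsExchangeAlong h W → IsExchange h
exchangeAlong⇒IsExchange {k} {n} {h} {W} trits along = trits , columns , cycle-or-path shape
  where
  open SimpleWalk W
  open IsExchangeAlong along

  v : Fin (suc m) → Fin k
  v t = V (toℕ t)

  v-injective : Injective _≡_ _≡_ v
  v-injective {t} {t′} = FinP.toℕ-injective ∘ V-injective (FinP.toℕ≤pred[n] t) (FinP.toℕ≤pred[n] t′)

  e : Fin p → Fin n
  e t = E (toℕ t)

  e-injective : Injective _≡_ _≡_ e
  e-injective {t} {t′} = FinP.toℕ-injective ∘ E-injective (FinP.toℕ<n t) (FinP.toℕ<n t′)

  cycle-or-path : p ≡ m ⊎ (p ≡ suc m × V (suc m) ≡ V 0) → IsSingleCycle h ⊎ IsSinglePath h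
  cycle-or-path (inj₁ refl) = inj₂ (m , 1≤m , v , e , v-injective , e-injective , λ i l j →
    ⇔-trans (steps i l j) (⇔-sym (path-steps⇔ V E (λ _ → refl) (λ _ → refl))))
  cycle-or-path (inj₂ (refl , closes)) = inj₁ (m , 1≤m , v , e , v-injective , e-injective , λ i l j →
    ⇔-trans (steps i l j) (⇔-sym (cycle-steps⇔ V E (λ _ → refl) (λ _ → refl) closes)))

extend : ∀ {A : Set} {m} .{{_ : ℕ.NonZero m}} → (Fin m → A) → ℕ → A
extend {m = m} f a = f (a mod m)

module _ {A : Set} {m} .{{_ : ℕ.NonZero m}} (f : Fin m → A) where

  private
    toℕ-mod : ∀ {a} → a < m → toℕ (a mod m) ≡ a
    toℕ-mod a<m = trans (FinP.toℕ-fromℕ< _) (DivMod.m<n⇒m%n≡m a<m)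

  extend-toℕ : ∀ t → extend f (toℕ t) ≡ f t
  extend-toℕ t = cong f (FinP.toℕ-injective (toℕ-mod (FinP.toℕ<n t)))

  extend-injective : Injective _≡_ _≡_ f → ∀ {a b} → a < m → b < m → extend f a ≡ extend f b → a ≡ b
  extend-injective f-injective a<m b<m eq =
    trans (sym (toℕ-mod a<m)) (trans (cong toℕ (f-injective eq)) (toℕ-mod b<m))

  extend-periodic : extend f m ≡ extend f 0
  extend-periodic = cong f (FinP.toℕ-injective (begin
    toℕ (m mod m)   ≡⟨ FinP.toℕ-fromℕ< _ ⟩
    m ℕ.% m         ≡⟨ DivMod.n%n≡0 m ⟩
    0               ≡⟨ toℕ-mod (ℕ.>-nonZero⁻¹ m) ⟨
    toℕ (0 mod m)   ∎))
    where open ≡-Reasoning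

module _ {k n} {h : Fin k → Fin n → ℤ} (columns : ∀ j → ColumnOK h j) where

  IsSinglePath⇒exchangeAlong : IsSinglePath h → Σ (SimpleWalk k n) (IsExchangeAlong h)
  IsSinglePath⇒exchangeAlong (m , 1≤m , v , e , v-injective , e-injective , steps) = W , along
    where
    instance
      m≢0 : ℕ.NonZero m
      m≢0 = ℕ.>-nonZero 1≤m
    W : SimpleWalk k n
    W = record
      { m = m ; p = m ; V = extend v ; E = extend e ; 1≤m = 1≤m ; shape = inj₁ refl
      ; V-injective = λ a≤m b≤m → extend-injective v v-injective (s≤s a≤m) (s≤s b≤m)
      ; E-injective = extend-injective e e-injective }
    along : IsExchangeAlong h W
    along = record
      { columns = columns
      ; steps   = λ i l j → ⇔-trans (steps i l j)
                    (path-steps⇔ (extend v) (extend e) (extend-toℕ v) (extend-toℕ e)) }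

  IsSingleCycle⇒exchangeAlong : IsSingleCycle h → Σ (SimpleWalk k n) (IsExchangeAlong h)
  IsSingleCycle⇒exchangeAlong (m , 1≤m , v , e , v-injective , e-injective , steps) = W , along
    where
    W : SimpleWalk k n
    W = record
      { m = m ; p = suc m ; V = extend v ; E = extend e ; 1≤m = 1≤m ; shape = inj₂ (refl , extend-periodic v)
      ; V-injective = λ a≤m b≤m → extend-injective v v-injective (s≤s a≤m) (s≤s b≤m)
      ; E-injective = extend-injective e e-injective }
    along : IsExchangeAlong h W
    along = record
      { columns = columns
      ; steps   = λ i l j → ⇔-trans (steps i l j)
                    (cycle-steps⇔ (extend v) (extend e) (extend-toℕ v) (extend-toℕ e) (extend-periodic v)) }

IsExchange⇒exchangeAlong : ∀ {k n} {h : Fin k → Fin n → ℤ} → IsExchange h →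
                           Σ (SimpleWalk k n) (IsExchangeAlong h)
IsExchange⇒exchangeAlong (_ , columns , cycle-or-path) =
  Data.Sum.[ IsSingleCycle⇒exchangeAlong columns , IsSinglePath⇒exchangeAlong columns ] cycle-or-path

stepEntry : ∀ {k} → Fin k → Fin k → Fin k → ℤ
stepEntry a b i with i Fin.≟ a | i Fin.≟ b
... | yes _ | _     = -1ℤ
... | no _  | yes _ = 1ℤ
... | no _  | no _  = 0ℤ

module _ {k} (a b : Fin k) where

  stepEntry-trit : ∀ i → Trit (stepEntry a b i)
  stepEntry-trit i with i Fin.≟ a | i Fin.≟ b
  ... | yes _ | _     = t-1
  ... | no _  | yes _ = t1
  ... | no _  | no _  = t0

  stepEntry-source : stepEntry a b a ≡ -1ℤ
  stepEntry-source with a Fin.≟ a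
  ... | yes _  = refl
  ... | no a≢a = contradiction refl a≢a

  stepEntry-target : a ≢ b → stepEntry a b b ≡ 1ℤ
  stepEntry-target a≢b with b Fin.≟ a | b Fin.≟ b
  ... | yes b≡a | _      = contradiction (sym b≡a) a≢b
  ... | no _    | yes _  = refl
  ... | no _    | no b≢b = contradiction refl b≢b

  stepEntry-off : ∀ {i} → i ≢ a → i ≢ b → stepEntry a b i ≡ 0ℤ
  stepEntry-off {i} i≢a i≢b with i Fin.≟ a | i Fin.≟ b
  ... | yes i≡a | _       = contradiction i≡a i≢a
  ... | no _    | yes i≡b = contradiction i≡b i≢b
  ... | no _    | no _    = refl

  stepEntry≡-1 : ∀ {i} → stepEntry a b i ≡ -1ℤ → i ≡ a
  stepEntry≡-1 {i} eq with i Fin.≟ a | i Fin.≟ b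
  ... | yes i≡a | _     = i≡a
  ... | no _    | yes _ = contradiction eq λ ()
  ... | no _    | no _  = contradiction eq λ ()

  stepEntry≡1 : ∀ {i} → stepEntry a b i ≡ 1ℤ → i ≡ b
  stepEntry≡1 {i} eq with i Fin.≟ a | i Fin.≟ b
  ... | yes _ | _       = contradiction eq λ ()
  ... | no _  | yes i≡b = i≡b
  ... | no _  | no _    = contradiction eq λ ()

module _ {k n} (W : SimpleWalk k n) where
  open SimpleWalk W

  Labelled : Fin n → Set
  Labelled j = ∃[ u ] (u < p × E u ≡ j)

  labelled? : ∀ j → Dec (Labelled j)
  labelled? j = Decidable.map (∃Fin⇔∃< (λ u → E u ≡ j)) (FinP.any? λ (t : Fin p) → E (toℕ t) Fin.≟ j)

  exchangeColumn : ∀ {j} → Dec (Labelled j) → Fin k → ℤ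
  exchangeColumn (yes (u , _)) = stepEntry (V u) (V (suc u))
  exchangeColumn (no _)        = λ _ → 0ℤ

  exchangeVector : Fin k → Fin n → ℤ
  exchangeVector i j = exchangeColumn (labelled? j) i

  exchangeVector-trit : ∀ i j → Trit (exchangeVector i j)
  exchangeVector-trit i j with labelled? j
  ... | yes (u , _) = stepEntry-trit (V u) (V (suc u)) i
  ... | no _        = t0

  private
    exchangeColumn-ok : ∀ {j} (d : Dec (Labelled j)) → ColumnOK (λ i _ → exchangeColumn d i) j
    exchangeColumn-ok (yes (u , u<p , _)) = inj₂ (V u , V (suc u) , step-moves W u<p ,
      stepEntry-source _ _ , stepEntry-target _ _ (step-moves W u<p) , λ _ → stepEntry-off _ _)
    exchangeColumn-ok (no _) = inj₁ λ _ → refl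

    exchangeColumn-steps : ∀ {i l j} (d : Dec (Labelled j)) →
                           (exchangeColumn d i ≡ -1ℤ × exchangeColumn d l ≡ 1ℤ) ⇔ StepOf W i l j
    exchangeColumn-steps {i} {l} {j} (yes (u , u<p , Eu≡j)) = mk⇔
      (λ (i-entry , l-entry) → u , u<p , Eu≡j , sym (stepEntry≡-1 _ _ i-entry) , sym (stepEntry≡1 _ _ l-entry))
      same-step
      where
      same-step : StepOf W i l j → stepEntry (V u) (V (suc u)) i ≡ -1ℤ × stepEntry (V u) (V (suc u)) l ≡ 1ℤ
      same-step (u′ , u′<p , Eu′≡j , refl , refl) with E-injective u<p u′<p (trans Eu≡j (sym Eu′≡j))
      ... | refl = stepEntry-source _ _ , stepEntry-target _ _ (step-moves W u<p)
    exchangeColumn-steps (no unlabelled) =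
      mk⇔ (λ ()) λ (u , u<p , Eu≡j , _) → contradiction (u , u<p , Eu≡j) unlabelled

  exchangeVector-along : IsExchangeAlong exchangeVector W
  exchangeVector-along = record
    { columns = λ j → exchangeColumn-ok (labelled? j)
    ; steps   = λ i l j → exchangeColumn-steps (labelled? j) }

-- Circuits are exchange vectors

record SignCompatible {k n} (g : Fin k → Fin n → ℤ) (W : SimpleWalk k n) : Set where
  open SimpleWalk W
  field
    leaves : ∀ {u} → u < p → g (V u) (E u) ℤ.< 0ℤ
    enters : ∀ {u} → u < p → 0ℤ ℤ.< g (V (suc u)) (E u)
    ends   : p ≡ m → sumℤ (g (V 0)) ≢ 0ℤ × sumℤ (g (V m)) ≢ 0ℤ

module _ {k n} {g : Fin k → Fin n → ℤ} {W : SimpleWalk k n} (compatible : SignCompatible g W) where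
  open SimpleWalk W
  open SignCompatible compatible
  open ExchangeAlong (exchangeVector-along W)

  private
    x : Fin k → Fin n → ℤ
    x = exchangeVector W

    x-row-sum-nonzero : ∀ {i} → sumℤ (x i) ≢ 0ℤ → sumℤ (g i) ≢ 0ℤ
    x-row-sum-nonzero sum≢0 with row-sum-nonzero⇒endpoint sum≢0
    ... | p≡m , inj₁ refl = proj₁ (ends p≡m)
    ... | p≡m , inj₂ refl = proj₂ (ends p≡m)

    x-nonzero : ∀ {i j} → x i j ≢ 0ℤ → g i j ≢ 0ℤ
    x-nonzero x≢0 with support-on-step x≢0
    ... | u , u<p , refl , inj₁ refl = ℤP.<⇒≢ (leaves u<p)
    ... | u , u<p , refl , inj₂ refl = ℤP.<⇒≢ (enters u<p) ∘ sym

  exchangeVector⊆compatible : ∀ r → SuppBℤ x r → SuppBℤ g r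
  exchangeVector⊆compatible (lower i)    s = x-row-sum-nonzero (s ∘ cong -_) ∘ ℤP.neg-injective
  exchangeVector⊆compatible (upper i)    s = x-row-sum-nonzero s
  exchangeVector⊆compatible (nonneg i j) s = x-nonzero (s ∘ cong -_) ∘ ℤP.neg-injective

  compatible-circuit≡exchangeVector : IsCircuit g → ∀ i j → g i j ≡ exchangeVector W i j
  compatible-circuit≡exchangeVector circuit =
    circuit-unique circuit x (ColumnOK⇒InKerℤ (IsExchangeAlong.columns (exchangeVector-along W)))
      exchangeVector⊆compatible (proj₁ (step-values (0<p W))) (leaves (0<p W))

sumℤ-nonneg : ∀ {m} (f : Fin m → ℤ) → (∀ r → 0ℤ ℤ.≤ f r) → 0ℤ ℤ.≤ sumℤ f
sumℤ-nonneg {zero}  f _   = ℤP.≤-refl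
sumℤ-nonneg {suc m} f f≥0 = ℤP.+-mono-≤ (f≥0 zero) (sumℤ-nonneg (f ∘ suc) (f≥0 ∘ suc))

nonneg-+-zero : ∀ {a b} → 0ℤ ℤ.≤ a → 0ℤ ℤ.≤ b → a + b ≡ 0ℤ → a ≡ 0ℤ × b ≡ 0ℤ
nonneg-+-zero {+ a} {+ b} _ _ a+b≡0 =
  cong +_ (ℕP.m+n≡0⇒m≡0 a (ℤP.+-injective a+b≡0)) , cong +_ (ℕP.m+n≡0⇒n≡0 a (ℤP.+-injective a+b≡0))

sumℤ-nonneg-zero : ∀ {m} (f : Fin m → ℤ) → (∀ r → 0ℤ ℤ.≤ f r) → sumℤ f ≡ 0ℤ → ∀ r → f r ≡ 0ℤ
sumℤ-nonneg-zero {suc m} f f≥0 sum≡0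
  with f₀≡0 , rest≡0 ← nonneg-+-zero (f≥0 zero) (sumℤ-nonneg (f ∘ suc) (f≥0 ∘ suc)) sum≡0 = λ where
    zero    → f₀≡0
    (suc r) → sumℤ-nonneg-zero (f ∘ suc) (f≥0 ∘ suc) rest≡0 r

sumℤ-neg : ∀ {m} (f : Fin m → ℤ) → sumℤ (λ r → - f r) ≡ - sumℤ f
sumℤ-neg {zero}  f = refl
sumℤ-neg {suc m} f =
  trans (cong (λ s → - f zero + s) (sumℤ-neg (f ∘ suc))) (sym (ℤP.neg-distrib-+ (f zero) _))

negative-entry : ∀ {m} (f : Fin m → ℤ) → sumℤ f ≡ 0ℤ → ∀ {a} → 0ℤ ℤ.< f a → ∃[ r ] f r ℤ.< 0ℤ
negative-entry f sum≡0 {a} 0<fa = Data.Product.map₂ ℤP.≰⇒>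
  (FinP.¬∀⟶∃¬ _ _ (λ r → 0ℤ ℤP.≤? f r) λ f≥0 → ℤP.<⇒≢ 0<fa (sym (sumℤ-nonneg-zero f f≥0 sum≡0 a)))

positive-entry : ∀ {m} (f : Fin m → ℤ) → sumℤ f ≡ 0ℤ → ∀ {a} → f a ℤ.< 0ℤ → ∃[ r ] 0ℤ ℤ.< f r
positive-entry f sum≡0 fa<0 =
  Data.Product.map₂ (λ {r} -fr<0 → subst (0ℤ ℤ.<_) (ℤP.neg-involutive (f r)) (ℤP.neg-mono-< -fr<0))
    (negative-entry (λ r → - f r) (trans (sumℤ-neg f) (cong -_ sum≡0)) (ℤP.neg-mono-< fa<0))

negative-entry-of-negative-sum : ∀ {m} (f : Fin m → ℤ) → sumℤ f ℤ.< 0ℤ → ∃[ r ] f r ℤ.< 0ℤ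
negative-entry-of-negative-sum f sum<0 = Data.Product.map₂ ℤP.≰⇒>
  (FinP.¬∀⟶∃¬ _ _ (λ r → 0ℤ ℤP.≤? f r) λ f≥0 → ℤP.<⇒≱ sum<0 (sumℤ-nonneg f f≥0))

witness-or : ∀ {A : Set} {P : A → Set} → Dec (∃ P) → A → A
witness-or (yes (a , _)) _       = a
witness-or (no _)        default = default

witness-or-spec : ∀ {A : Set} {P : A → Set} (d : Dec (∃ P)) (default : A) → ∃ P → P (witness-or d default)
witness-or-spec (yes (_ , pa)) _ _  = pa
witness-or-spec (no ∄P)        _ ∃P = contradiction ∃P ∄P

minimal-witness : ∀ {P : ℕ → Set} → (∀ t → Dec (P t)) → ∀ {b} → P b →
                  ∃[ t ] (P t × (∀ {s} → s < t → ¬ P s))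
minimal-witness P? {zero} p0 = 0 , p0 , λ ()
minimal-witness {P} P? {suc b} pb with minimal-witness (P? ∘ suc) pb | P? 0
... | _                 | yes p0 = 0 , p0 , λ ()
... | t , pt , minimal  | no ¬p0 = suc t , pt , below
  where
  below : ∀ {s} → s < suc t → ¬ P s
  below {zero}  _         = ¬p0
  below {suc s} (s≤s s<t) = minimal s<t

cycle-successor-injective : ∀ {A : Set} {m} {V : ℕ → A} → (∀ {a b} → a ≤ m → b ≤ m → V a ≡ V b → a ≡ b) →
                            V (suc m) ≡ V 0 → ∀ {a b} → a ≤ m → b ≤ m → V (suc a) ≡ V (suc b) → a ≡ b
cycle-successor-injective V-injective closes a≤m b≤m eq
  with ℕP.m≤n⇒m<n∨m≡n a≤m | ℕP.m≤n⇒m<n∨m≡n b≤m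
... | inj₁ a<m  | inj₁ b<m  = ℕP.suc-injective (V-injective a<m b<m eq)
... | inj₁ a<m  | inj₂ refl = contradiction (V-injective a<m z≤n (trans eq closes)) ℕP.1+n≢0
... | inj₂ refl | inj₁ b<m  = contradiction (V-injective b<m z≤n (trans (sym eq) closes)) ℕP.1+n≢0
... | inj₂ refl | inj₂ refl = refl

module CompatibleWalk {k n} (g : Fin k → Fin n → ℤ) (ker : InKerℤ g) {i₀ j₀} (g₀≢0 : g i₀ j₀ ≢ 0ℤ) where

  R : Fin k → ℤ
  R i = sumℤ (g i)

  row-sums-balanced : (∀ i → 0ℤ ℤ.≤ R i) → ∀ i → R i ≡ 0ℤ
  row-sums-balanced R≥0 = sumℤ-nonneg-zero R R≥0 (begin
    sumℤ R                                  ≡⟨ sumℤ≡sum R ⟩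
    ℤΣ.sum (λ i → sumℤ (g i))               ≡⟨ ℤΣ.sum-cong-≗ (λ i → sumℤ≡sum (g i)) ⟩
    ℤΣ.sum (λ i → ℤΣ.sum (g i))             ≡⟨ ℤΣ.∑-comm g ⟩
    ℤΣ.sum (λ j → ℤΣ.sum (λ i → g i j))     ≡⟨ ℤΣ.sum-zero _ (λ j → trans (sym (sumℤ≡sum (λ i → g i j))) (ker j)) ⟩
    0ℤ                                      ∎)
    where open ≡-Reasoning

  leaving : Fin k → Fin n
  leaving i = witness-or (FinP.any? λ j → g i j ℤP.<? 0ℤ) j₀

  leaving-negative : ∀ {i} → ∃[ j ] g i j ℤ.< 0ℤ → g i (leaving i) ℤ.< 0ℤ
  leaving-negative {i} = witness-or-spec (FinP.any? λ j → g i j ℤP.<? 0ℤ) j₀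

  entering : Fin n → Fin k
  entering j = witness-or (FinP.any? λ i → 0ℤ ℤP.<? g i j) i₀

  entering-positive : ∀ {j} → ∃[ i ] 0ℤ ℤ.< g i j → 0ℤ ℤ.< g (entering j) j
  entering-positive {j} = witness-or-spec (FinP.any? λ i → 0ℤ ℤP.<? g i j) i₀

  some-negative-entry : ∃[ i ] ∃[ j ] g i j ℤ.< 0ℤ
  some-negative-entry with ℤP.<-cmp (g i₀ j₀) 0ℤ
  ... | tri< g₀<0 _ _ = i₀ , j₀ , g₀<0
  ... | tri≈ _ g₀≡0 _ = contradiction g₀≡0 g₀≢0
  ... | tri> _ _ g₀>0 = Data.Product.map₂ (j₀ ,_) (negative-entry (λ i → g i j₀) (ker j₀) g₀>0)

  -- a row of negative sum if there is one, so that a path ending at an unbalanced row also starts at one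
  start : Fin k
  start = witness-or (FinP.any? λ i → R i ℤP.<? 0ℤ) (proj₁ some-negative-entry)

  start-leaves : ∃[ j ] g start j ℤ.< 0ℤ
  start-leaves with FinP.any? (λ i → R i ℤP.<? 0ℤ)
  ... | yes (i , Ri<0) = negative-entry-of-negative-sum (g i) Ri<0
  ... | no _           = proj₂ some-negative-entry

  start-unbalanced : ∀ {i} → R i ≢ 0ℤ → R start ≢ 0ℤ
  start-unbalanced {i} Ri≢0 with FinP.any? (λ i → R i ℤP.<? 0ℤ)
  ... | yes (_ , R<0) = ℤP.<⇒≢ R<0
  ... | no ∄R<0       = contradiction (row-sums-balanced (λ i → ℤP.≮⇒≥ (∄R<0 ∘ (i ,_))) i) Ri≢0

  w : ℕ → Fin k
  w zero    = start
  w (suc t) = entering (leaving (w t))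

  c : ℕ → Fin n
  c t = leaving (w t)

  Revisits : ℕ → Set
  Revisits t = ∃[ s ] (s < t × w s ≡ w t)

  -- the walk is cut at its first revisit (a cycle) or at its first later unbalanced row (a path)
  Stops : ℕ → Set
  Stops t = 1 ≤ t × (Revisits t ⊎ R (w t) ≢ 0ℤ)

  revisits? : ∀ t → Dec (Revisits t)
  revisits? t = Decidable.map (∃Fin⇔∃< (λ s → w s ≡ w t)) (FinP.any? λ (s : Fin t) → w (toℕ s) Fin.≟ w t)

  stops? : ∀ t → Dec (Stops t)
  stops? t = 1 ℕ.≤? t ×-dec (revisits? t ⊎-dec ¬? (R (w t) ℤ.≟ 0ℤ))

  eventually-stops : ∃[ t ] Stops t
  eventually-stops
    with a , b , a<b , wa≡wb ← FinP.pigeonhole (ℕP.n<1+n k) (λ (t : Fin (suc k)) → w (toℕ t)) =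
    toℕ b , ℕP.≤-trans (s≤s z≤n) a<b , inj₁ (toℕ a , a<b , wa≡wb)

  module _ {t₀} (stops : Stops t₀) (before : ∀ {t} → t < t₀ → ¬ Stops t) where

    distinct-before : ∀ {a b} → a < b → b < t₀ → w a ≢ w b
    distinct-before a<b b<t₀ wa≡wb = before b<t₀ (ℕP.≤-trans (s≤s z≤n) a<b , inj₁ (_ , a<b , wa≡wb))

    injective-before : ∀ {a b} → a < t₀ → b < t₀ → w a ≡ w b → a ≡ b
    injective-before {a} {b} a<t₀ b<t₀ wa≡wb with ℕP.<-cmp a b
    ... | tri< a<b _ _ = contradiction wa≡wb (distinct-before a<b b<t₀)
    ... | tri≈ _ a≡b _ = a≡b
    ... | tri> _ _ b<a = contradiction (sym wa≡wb) (distinct-before b<a a<t₀)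

    balanced-before : ∀ {t} → 1 ≤ t → t < t₀ → R (w t) ≡ 0ℤ
    balanced-before 1≤t t<t₀ = ≢0-stableℤ λ unbalanced → before t<t₀ (1≤t , inj₂ unbalanced)

    leaves : ∀ {t} → t < t₀ → g (w t) (c t) ℤ.< 0ℤ
    enters : ∀ {t} → t < t₀ → 0ℤ ℤ.< g (w (suc t)) (c t)

    leaves {zero}  _      = leaving-negative start-leaves
    leaves {suc t} 1+t<t₀ = leaving-negative
      (negative-entry (g (w (suc t))) (balanced-before (s≤s z≤n) 1+t<t₀)
                      (enters (ℕP.<-trans (ℕP.n<1+n t) 1+t<t₀)))
    enters {t} t<t₀ = entering-positive (positive-entry (λ i → g i (c t)) (ker (c t)) (leaves t<t₀))

    moves : ∀ {t} → t < t₀ → w t ≢ w (suc t)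
    moves {t} t<t₀ wt≡w1+t =
      ℤP.<-asym (leaves t<t₀) (subst (λ i → 0ℤ ℤ.< g i (c t)) (sym wt≡w1+t) (enters t<t₀))

    cycle : Revisits t₀ → Σ (SimpleWalk k n) (SignCompatible g)
    cycle (s , s<t₀ , ws≡wt₀) with ℕP.m≤n⇒∃[o]m+o≡n s<t₀
    ... | zero , 1+s+0≡t₀ = contradiction (trans ws≡wt₀ (cong w (sym 1+s≡t₀))) (moves s<t₀)
      where
      1+s≡t₀ : suc s ≡ t₀
      1+s≡t₀ = trans (sym (ℕP.+-identityʳ (suc s))) 1+s+0≡t₀
    ... | suc d , 1+s+m≡t₀ =
      W , record { leaves = leaves ∘ offset ∘ ℕP.≤-pred ; enters = enters′ ; ends = λ () }
      where
      m : ℕ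
      m = suc d
      offset : ∀ {a} → a ≤ m → s ℕ.+ a < t₀
      offset a≤m = subst (_ <_) 1+s+m≡t₀ (s≤s (ℕP.+-monoʳ-≤ s a≤m))
      closes : w (s ℕ.+ suc m) ≡ w (s ℕ.+ 0)
      closes = trans (cong w (trans (ℕP.+-suc s m) 1+s+m≡t₀))
                     (trans (sym ws≡wt₀) (cong w (sym (ℕP.+-identityʳ s))))
      V-injective : ∀ {a b} → a ≤ m → b ≤ m → w (s ℕ.+ a) ≡ w (s ℕ.+ b) → a ≡ b
      V-injective a≤m b≤m = ℕP.+-cancelˡ-≡ s _ _ ∘ injective-before (offset a≤m) (offset b≤m)
      W : SimpleWalk k n
      W = record
        { m = m ; p = suc m ; V = λ a → w (s ℕ.+ a) ; E = λ a → c (s ℕ.+ a) ; 1≤m = s≤s z≤n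
        ; shape = inj₂ (refl , closes)
        ; V-injective = V-injective
        ; E-injective = λ {a} {b} a<p b<p Ea≡Eb → cycle-successor-injective V-injective closes
            (ℕP.≤-pred a<p) (ℕP.≤-pred b<p)
            (trans (cong w (ℕP.+-suc s a)) (trans (cong entering Ea≡Eb) (cong w (sym (ℕP.+-suc s b))))) }
      enters′ : ∀ {u} → u < suc m → 0ℤ ℤ.< g (w (s ℕ.+ suc u)) (c (s ℕ.+ u))
      enters′ {u} u<p =
        subst (λ t → 0ℤ ℤ.< g (w t) (c (s ℕ.+ u))) (sym (ℕP.+-suc s u)) (enters (offset (ℕP.≤-pred u<p)))

    path : ¬ Revisits t₀ → R (w t₀) ≢ 0ℤ → Σ (SimpleWalk k n) (SignCompatible g)
    path no-revisit unbalanced =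
      W , record { leaves = leaves ; enters = enters ; ends = λ _ → start-unbalanced unbalanced , unbalanced }
      where
      V-injective : ∀ {a b} → a ≤ t₀ → b ≤ t₀ → w a ≡ w b → a ≡ b
      V-injective {a} {b} a≤t₀ b≤t₀ wa≡wb with ℕP.m≤n⇒m<n∨m≡n a≤t₀ | ℕP.m≤n⇒m<n∨m≡n b≤t₀
      ... | inj₁ a<t₀ | inj₁ b<t₀ = injective-before a<t₀ b<t₀ wa≡wb
      ... | inj₁ a<t₀ | inj₂ refl = contradiction (a , a<t₀ , wa≡wb) no-revisit
      ... | inj₂ refl | inj₁ b<t₀ = contradiction (b , b<t₀ , sym wa≡wb) no-revisit
      ... | inj₂ refl | inj₂ refl = refl
      W : SimpleWalk k n
      W = record
        { m = t₀ ; p = t₀ ; V = w ; E = c ; 1≤m = proj₁ stops ; shape = inj₁ refl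
        ; V-injective = V-injective
        ; E-injective = λ a<t₀ b<t₀ → ℕP.suc-injective ∘ V-injective a<t₀ b<t₀ ∘ cong entering }

    stopped-walk : Σ (SimpleWalk k n) (SignCompatible g)
    stopped-walk with revisits? t₀
    ... | yes revisits  = cycle revisits
    ... | no no-revisit =
      path no-revisit (Data.Sum.[ (λ revisits → contradiction revisits no-revisit) , id ] (proj₂ stops))

  compatible-walk : Σ (SimpleWalk k n) (SignCompatible g)
  compatible-walk with t₀ , stops , before ← minimal-witness stops? (proj₂ eventually-stops) =
    stopped-walk stops before

IsExchangeAlong-resp : ∀ {k n} {g h : Fin k → Fin n → ℤ} {W : SimpleWalk k n} →
                       (∀ i j → g i j ≡ h i j) → IsExchangeAlong h W → IsExchangeAlong g W
IsExchangeAlong-resp {g = g} {h} g≡h along = record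
  { columns = λ j → column-resp (columns j)
  ; steps   = λ i l j → ⇔-trans (≡×≡-⇔ (g≡h i j) (g≡h l j)) (steps i l j) }
  where
  open IsExchangeAlong along
  column-resp : ∀ {j} → ColumnOK h j → ColumnOK g j
  column-resp {j} (inj₁ h·j≡0) = inj₁ λ i → trans (g≡h i j) (h·j≡0 i)
  column-resp {j} (inj₂ (i , l , i≢l , hi , hl , off)) =
    inj₂ (i , l , i≢l , trans (g≡h i j) hi , trans (g≡h l j) hl ,
          λ r r≢i r≢l → trans (g≡h r j) (off r r≢i r≢l))
  ≡×≡-⇔ : ∀ {a a′ b b′ x y : ℤ} → a ≡ a′ → b ≡ b′ → (a ≡ x × b ≡ y) ⇔ (a′ ≡ x × b′ ≡ y)
  ≡×≡-⇔ refl refl = ⇔-refl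

IsCircuit⇒IsExchange : ∀ {k n} {g : Fin k → Fin n → ℤ} → IsCircuit g → IsExchange g
IsCircuit⇒IsExchange {g = g} circuit@(ker , (_ , _ , g₀≢0) , _)
  with W , compatible ← CompatibleWalk.compatible-walk g ker g₀≢0 =
  exchangeAlong⇒IsExchange (λ i j → subst Trit (sym (g≡x i j)) (exchangeVector-trit W i j))
                           (IsExchangeAlong-resp g≡x (exchangeVector-along W))
  where
  g≡x : ∀ i j → g i j ≡ exchangeVector W i j
  g≡x = compatible-circuit≡exchangeVector compatible circuit

IsExchange⇒IsCircuit : ∀ {k n} {g : Fin k → Fin n → ℤ} → IsExchange g → IsCircuit g
IsExchange⇒IsCircuit = exchangeAlong⇒IsCircuit ∘ proj₂ ∘ IsExchange⇒exchangeAlong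

lemma4 : (k n : ℕ) (κ⁻ κ⁺ : Fin k → ℕ) (g : Fin k → Fin n → ℤ) →
    IsCircuit g ⇔ IsExchange g
lemma4 k n κ⁻ κ⁺ g = mk⇔ IsCircuit⇒IsExchange IsExchange⇒IsCircuit
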